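{- Let $\mu$ be a $p$-symmetric fuzzy measure on the finite set $X$ with respect to the partition $\{A_1,\dots,A_p\}$, and let $m$ be its Möbius transform. Then for every $B\subset X$ with profile $(b_1,\dots,b_p)$, $$ m(B)=\sum_{i_1\le b_1,\dots,i_p\le b_p}(-1)^{b_1+\dots+b_p-i_1-\dots-i_p}\binom{b_1}{i_1}\cdots\binom{b_p}{i_p}\,\mu(i_1,\dots,i_p),$$ where the sum runs over integers $0\le i_k\le b_k$.
   Context: A fuzzy measure on a finite set $X$ is a set function $\mu:\mathcal P(X)\to[0,1]$ with $\mu(\emptyset)=0$, $\mu(X)=1$, and monotone. A subset $A\subset X$ is a set of indifference for $\mu$ if for all $B_1,B_2\subset A$ with $|B_1|=|B_2|$ and all $C\subset X\setminus A$, $\mu(B_1\cup C)=\mu(B_2\cup C)$. $\mu$ is $p$-symmetric with respect to the partition $\{A_1,\dots,A_p\}$ of $X$ (all $A_i\ne\emptyset$) if this is the coarsest partition of $X$ into sets of indifference for $\mu$. The profile of $C\subset X$ is $(c_1,\dots,c_p)$ with $c_i=|C\cap A_i|$; for a $p$-symmetric $\mu$, $\mu(C)$ depends only on the profile of $C$, and $\mu(c_1,\dots,c_p)$ denotes this common value. The Möbius transform of $\mu$ is $m(A)=\sum_{B\subset A}(-1)^{|A\setminus B|}\mu(B)$. -}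

module Defs where

open import Level using (Level; _⊔_) renaming (suc to lsuc)
open import Data.Nat using (ℕ; zero; suc; _∸_)
open import Data.Nat.Combinatorics using (_C_)
open import Data.Fin using (Fin; _≟_)
open import Data.Fin.Subset using (Subset; inside; outside; _⊆_; _∩_; _∪_; _─_; ∁; ∣_∣; ⊥; ⊤)
open import Data.Fin.Subset.Properties using (_⊆?_)
open import Data.Vec using (Vec; []; _∷_; tabulate)
open import Data.List using (List; []; _∷_; [_]; map; _++_; foldr; filter)
open import Data.Product using (_×_; Σ)
open import Relation.Nullary.Decidable using (does)
open import Relation.Binary.PropositionalEquality using (_≡_)
open import Algebra.Bundles using (CommutativeRing)

allSubsets : (n : ℕ) → List (Subset n)
allSubsets zero    = [ [] ]
allSubsets (suc n) = map (inside ∷_) (allSubsets n) ++ map (outside ∷_) (allSubsets n)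

-- A partition of X = Fin n into p blocks A_0, …, A_{p-1} is given by the map
-- cls : Fin n → Fin p sending x to the index of its block.
-- Block A_k as a subset of X.
block : {n p : ℕ} → (Fin n → Fin p) → Fin p → Subset n
block cls k = tabulate (λ x → does (cls x ≟ k))

AllBlocksNonempty : {n p : ℕ} → (Fin n → Fin p) → Set
AllBlocksNonempty {n} {p} cls = (k : Fin p) → Σ (Fin n) (λ x → cls x ≡ k)

profile : {n p : ℕ} → (Fin n → Fin p) → Subset n → Vec ℕ p
profile cls C = tabulate (λ k → ∣ C ∩ block cls k ∣)

Refines : {n p q : ℕ} → (Fin n → Fin q) → (Fin n → Fin p) → Set
Refines g cls = ∀ x y → g x ≡ g y → cls x ≡ cls y

module _ {c ℓ : Level} (R : CommutativeRing c ℓ) where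
  open CommutativeRing R

  negOnePow : ℕ → Carrier
  negOnePow zero    = 1#
  negOnePow (suc k) = - negOnePow k

  fromℕ : ℕ → Carrier
  fromℕ zero    = 0#
  fromℕ (suc k) = 1# + fromℕ k

  sumList : List Carrier → Carrier
  sumList = foldr _+_ 0#

  sumUpTo : ℕ → (ℕ → Carrier) → Carrier
  sumUpTo zero    f = f 0
  sumUpTo (suc b) f = sumUpTo b f + f (suc b)

  sumBox : {p : ℕ} → Vec ℕ p → (Vec ℕ p → Carrier) → Carrier
  sumBox []       f = f []
  sumBox (b ∷ bs) f = sumUpTo b (λ i → sumBox bs (λ is → f (i ∷ is)))

  record FuzzyMeasure {ℓ' : Level} (_≤_ : Carrier → Carrier → Set ℓ') {n : ℕ}
                      (μ : Subset n → Carrier) : Set (c ⊔ ℓ ⊔ ℓ') where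
    field
      inUnit   : ∀ A → (0# ≤ μ A) × (μ A ≤ 1#)
      empty    : μ ⊥ ≈ 0#
      full     : μ ⊤ ≈ 1#
      monotone : ∀ A B → A ⊆ B → μ A ≤ μ B

  SetOfIndifference : {n : ℕ} → (Subset n → Carrier) → Subset n → Set ℓ
  SetOfIndifference μ A =
    ∀ B₁ B₂ C → B₁ ⊆ A → B₂ ⊆ A → ∣ B₁ ∣ ≡ ∣ B₂ ∣ → C ⊆ ∁ A →
    μ (B₁ ∪ C) ≈ μ (B₂ ∪ C)

  record PSymmetric {n p : ℕ} (μ : Subset n → Carrier) (cls : Fin n → Fin p) : Set (lsuc ℓ) where
    field
      nonempty     : AllBlocksNonempty cls
      indifference : ∀ k → SetOfIndifference μ (block cls k)
      coarsest     : ∀ (q : ℕ) (g : Fin n → Fin q) → AllBlocksNonempty g →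
                     (∀ k → SetOfIndifference μ (block g k)) → Refines g cls

  mobius : {n : ℕ} → (Subset n → Carrier) → Subset n → Carrier
  mobius {n} μ A =
    sumList (map (λ B → negOnePow ∣ A ─ B ∣ * μ B)
                 (filter (λ B → B ⊆? A) (allSubsets n)))

  sumVec : {p : ℕ} → Vec ℕ p → ℕ
  sumVec []       = 0
  sumVec (x ∷ xs) = x Data.Nat.+ sumVec xs

  binomProd : {p : ℕ} → Vec ℕ p → Vec ℕ p → Carrier
  binomProd []       []       = 1#
  binomProd (b ∷ bs) (i ∷ is) = fromℕ (b C i) * binomProd bs is

module Submission where

-- Write Δᵏ for the forward difference in the k-th coordinate of
-- a function F on ℕᵖ.  The right-hand side of the formula is exactly the
-- iterated difference (Δ¹)^{b₁} ⋯ (Δᵖ)^{bₚ} μP evaluated at the origin,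
-- written out with binomial coefficients.  On the other side, the Möbius
-- transform m(B) = Σ_{D ⊆ B} (-1)^{|B \ D|} μ(D) is the iterated difference of
-- μ along the elements of B, taken at the empty set.  Adding the element x
-- to D adds one to the coordinate of its block in the profile of D, so when
-- μ = μP ∘ profile a difference along x ∈ B is a difference Δᵏ along the
-- block k of x; composing these over all x ∈ B gives the claim.

open import Defs
open import Level using (Level)
open import Data.Nat as ℕ using (ℕ; zero; suc; _∸_; _≤_; _<_; z≤n)
open import Data.Nat.Properties
  using (≤-refl; m≤n⇒m≤1+n; n<1+n; _<?_; ≰⇒>; +-mono-≤; ∸-+-assoc; +-∸-comm; +-∸-assoc)
open import Data.Nat.Combinatorics using (_C_; nCk+nC[k+1]≡[n+1]C[k+1]; k>n⇒nCk≡0)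
open import Data.Fin using (Fin; zero; suc; _≟_)
open import Data.Fin.Subset using (Subset; inside; outside; _─_; ∣_∣)
open import Data.Fin.Subset.Properties using (_⊆?_)
open import Data.Vec using (Vec; []; _∷_; tabulate)
open import Data.List using (List; []; _∷_; map; _++_; filter)
open import Data.List.Properties using (map-++; map-∘)
open import Data.Bool as Bool using (Bool; true; false; if_then_else_)
open import Relation.Nullary using (does; yes; no)
open import Relation.Unary using (Pred; Decidable)
open import Relation.Binary.PropositionalEquality as ≡ using (_≡_)
open import Function using (_∘_; id)
open import Algebra.Bundles using (CommutativeRing)

bump : {p : ℕ} → Fin p → Vec ℕ p → Vec ℕ p
bump zero    (x ∷ xs) = suc x ∷ xs
bump (suc k) (x ∷ xs) = x ∷ bump k xs

-- Adding the first point of X to a subset bumps the coordinate of its block;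
-- the helper states this for the tabulated form in which profiles compute.
profile-inside : {n p : ℕ} (cls : Fin (suc n) → Fin p) (D : Subset n) →
  profile cls (inside ∷ D) ≡ bump (cls zero) (profile (cls ∘ suc) D)
profile-inside cls D = bump-tabulate (cls zero) _
  where
  bump-tabulate : {p : ℕ} (k : Fin p) (g : Fin p → ℕ) →
    tabulate (λ k' → (if does (does (k ≟ k') Bool.≟ true) then suc else id) (g k'))
      ≡ bump k (tabulate g)
  bump-tabulate {suc p} zero    g = ≡.refl
  bump-tabulate {suc p} (suc k) g = ≡.cong (g zero ∷_) (bump-tabulate k (g ∘ suc))

data _≤ᵛ_ : {p : ℕ} → Vec ℕ p → Vec ℕ p → Set where
  []  : [] ≤ᵛ []
  _∷_ : {p i b : ℕ} {is bs : Vec ℕ p} → i ≤ b → is ≤ᵛ bs → (i ∷ is) ≤ᵛ (b ∷ bs)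

-- Truncated subtraction distributes over sums when no truncation occurs; needed to split the global sign (-1)^{Σb - Σi} coordinatewise.
∸-split : (b B j J : ℕ) → j ≤ b → J ≤ B → (b ℕ.+ B) ∸ (j ℕ.+ J) ≡ (b ∸ j) ℕ.+ (B ∸ J)
∸-split b B j J j≤b J≤B = begin
  (b ℕ.+ B) ∸ (j ℕ.+ J)  ≡⟨ ∸-+-assoc (b ℕ.+ B) j J ⟨
  (b ℕ.+ B) ∸ j ∸ J      ≡⟨ ≡.cong (_∸ J) (+-∸-comm B j≤b) ⟩
  (b ∸ j) ℕ.+ B ∸ J      ≡⟨ +-∸-assoc (b ∸ j) J≤B ⟩
  (b ∸ j) ℕ.+ (B ∸ J)    ∎
  where open ≡.≡-Reasoning

module _ {c ℓ : Level} (R : CommutativeRing c ℓ) where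
  open CommutativeRing R hiding (zero)
  open import Algebra.Properties.Ring ring
    using (-0#≈0#; -‿+-comm; -‿distribˡ-*; -‿distribʳ-*)
  open import Algebra.Properties.CommutativeSemigroup +-commutativeSemigroup
    using () renaming (interchange to +-interchange)
  open import Algebra.Properties.CommutativeSemigroup *-commutativeSemigroup
    using () renaming (interchange to *-interchange)
  open import Relation.Binary.Reasoning.Setoid setoid

  sumUpTo-cong : (b : ℕ) {f g : ℕ → Carrier} → (∀ j → j ≤ b → f j ≈ g j) →
    sumUpTo R b f ≈ sumUpTo R b g
  sumUpTo-cong zero    f≈g = f≈g 0 z≤n
  sumUpTo-cong (suc b) f≈g =
    +-cong (sumUpTo-cong b (λ j j≤b → f≈g j (m≤n⇒m≤1+n j≤b))) (f≈g (suc b) ≤-refl)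

  sumUpTo-sub : (b : ℕ) (f g : ℕ → Carrier) →
    sumUpTo R b (λ j → f j - g j) ≈ sumUpTo R b f - sumUpTo R b g
  sumUpTo-sub zero    f g = refl
  sumUpTo-sub (suc b) f g = begin
    sumUpTo R b (λ j → f j - g j) + (f (suc b) - g (suc b))
      ≈⟨ +-congʳ (sumUpTo-sub b f g) ⟩
    (sumUpTo R b f - sumUpTo R b g) + (f (suc b) - g (suc b))
      ≈⟨ +-interchange _ _ _ _ ⟩
    (sumUpTo R b f + f (suc b)) + (- sumUpTo R b g + - g (suc b))
      ≈⟨ +-congˡ (-‿+-comm _ _) ⟩
    (sumUpTo R b f + f (suc b)) - (sumUpTo R b g + g (suc b))
      ∎

  sumUpTo-*ˡ : (b : ℕ) (x : Carrier) (f : ℕ → Carrier) →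
    x * sumUpTo R b f ≈ sumUpTo R b (λ j → x * f j)
  sumUpTo-*ˡ zero    x f = refl
  sumUpTo-*ˡ (suc b) x f = trans (distribˡ x _ _) (+-congʳ (sumUpTo-*ˡ b x f))

  sumUpTo-shift : (b : ℕ) (f : ℕ → Carrier) →
    sumUpTo R (suc b) f ≈ f 0 + sumUpTo R b (f ∘ suc)
  sumUpTo-shift zero    f = refl
  sumUpTo-shift (suc b) f = trans (+-congʳ (sumUpTo-shift b f)) (+-assoc _ _ _)

  sumBox-cong : {p : ℕ} (b : Vec ℕ p) {f g : Vec ℕ p → Carrier} →
    (∀ i → i ≤ᵛ b → f i ≈ g i) → sumBox R b f ≈ sumBox R b g
  sumBox-cong []       f≈g = f≈g [] []
  sumBox-cong (b ∷ bs) f≈g =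
    sumUpTo-cong b (λ j j≤b → sumBox-cong bs (λ is is≤bs → f≈g (j ∷ is) (j≤b ∷ is≤bs)))

  sumBox-*ˡ : {p : ℕ} (x : Carrier) (b : Vec ℕ p) (f : Vec ℕ p → Carrier) →
    x * sumBox R b f ≈ sumBox R b (λ i → x * f i)
  sumBox-*ˡ x []       f = refl
  sumBox-*ˡ x (b ∷ bs) f =
    trans (sumUpTo-*ˡ b x _) (sumUpTo-cong b (λ j _ → sumBox-*ˡ x bs _))

  fromℕ-+ : (m k : ℕ) → fromℕ R (m ℕ.+ k) ≈ fromℕ R m + fromℕ R k
  fromℕ-+ zero    k = sym (+-identityˡ _)
  fromℕ-+ (suc m) k = trans (+-congˡ (fromℕ-+ m k)) (sym (+-assoc _ _ _))

  negOnePow-+ : (m k : ℕ) → negOnePow R (m ℕ.+ k) ≈ negOnePow R m * negOnePow R k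
  negOnePow-+ zero    k = sym (*-identityˡ _)
  negOnePow-+ (suc m) k = trans (-‿cong (negOnePow-+ m k)) (-‿distribˡ-* _ _)

  -- The binomial weights (-1)^{b-j} binom(b,j) of the b-th forward difference
  -- Δ^b H(0) = Σ_{j ≤ b} (-1)^{b-j} binom(b,j) H(j).

  weight : ℕ → ℕ → Carrier
  weight b j = negOnePow R (b ∸ j) * fromℕ R (b C j)

  binomial-vanishes : (b j : ℕ) → b < j → (x : Carrier) → x * fromℕ R (b C j) ≈ 0#
  binomial-vanishes b j b<j x =
    trans (*-congˡ (reflexive (≡.cong (fromℕ R) (k>n⇒nCk≡0 b<j)))) (zeroʳ x)

  -- Moving the index j to j+1 flips the sign (or the term is zero anyway);
  -- for j < b, b ∸ j = (1 + b) ∸ (1 + j) = 1 + (b ∸ (1 + j)).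
  weight-sign-flip : (b j : ℕ) →
    negOnePow R (b ∸ j) * fromℕ R (b C suc j) ≈ - weight b (suc j)
  weight-sign-flip b j with j <? b
  ... | yes j<b = trans (*-congʳ (reflexive (≡.cong (negOnePow R) (+-∸-assoc 1 j<b))))
                        (sym (-‿distribˡ-* _ _))
  ... | no  j≮b = trans (binomial-vanishes b (suc j) (≰⇒> j≮b) _)
                        (sym (trans (-‿cong (binomial-vanishes b (suc j) (≰⇒> j≮b) _))
                                    -0#≈0#))

  weightPred : ℕ → ℕ → Carrier
  weightPred b zero    = 0#
  weightPred b (suc j) = weight b j

  -- Pascal's rule for the weights: binom(b+1,j+1) = binom(b,j) + binom(b,j+1).
  weight-pascal : (b j : ℕ) → weight (suc b) j ≈ weightPred b j - weight b j
  weight-pascal b zero    = trans (sym (-‿distribˡ-* _ _)) (sym (+-identityˡ _))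
  weight-pascal b (suc j) = begin
    negOnePow R (b ∸ j) * fromℕ R (suc b C suc j)
      ≈⟨ *-congˡ (reflexive (≡.cong (fromℕ R) (≡.sym (nCk+nC[k+1]≡[n+1]C[k+1] b j)))) ⟩
    negOnePow R (b ∸ j) * fromℕ R (b C j ℕ.+ b C suc j)
      ≈⟨ *-congˡ (fromℕ-+ (b C j) (b C suc j)) ⟩
    negOnePow R (b ∸ j) * (fromℕ R (b C j) + fromℕ R (b C suc j))
      ≈⟨ distribˡ _ _ _ ⟩
    weight b j + negOnePow R (b ∸ j) * fromℕ R (b C suc j)
      ≈⟨ +-congˡ (weight-sign-flip b j) ⟩
    weight b j - weight b (suc j)
      ∎

  -- Δ^{b+1} H(0) = Δ^b (ΔH)(0) with ΔH(j) = H(j+1) - H(j), in binomial form.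
  difference-suc : (b : ℕ) (H : ℕ → Carrier) →
    sumUpTo R (suc b) (λ j → weight (suc b) j * H j)
      ≈ sumUpTo R b (λ j → weight b j * H (suc j)) - sumUpTo R b (λ j → weight b j * H j)
  difference-suc b H = begin
    sumUpTo R (suc b) (λ j → weight (suc b) j * H j)
      ≈⟨ sumUpTo-cong (suc b) (λ j _ → pascal-term j) ⟩
    sumUpTo R (suc b) (λ j → weightPred b j * H j - weight b j * H j)
      ≈⟨ sumUpTo-sub (suc b) _ _ ⟩
    sumUpTo R (suc b) (λ j → weightPred b j * H j) - sumUpTo R (suc b) (λ j → weight b j * H j)
      ≈⟨ +-cong shifted-part (-‿cong (trans (+-congˡ top-term) (+-identityʳ _))) ⟩
    sumUpTo R b (λ j → weight b j * H (suc j)) - sumUpTo R b (λ j → weight b j * H j)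
      ∎
    where
    pascal-term : (j : ℕ) → weight (suc b) j * H j ≈ weightPred b j * H j - weight b j * H j
    pascal-term j = trans (*-congʳ (weight-pascal b j))
                          (trans (distribʳ _ _ _) (+-congˡ (sym (-‿distribˡ-* _ _))))
    shifted-part : sumUpTo R (suc b) (λ j → weightPred b j * H j)
                     ≈ sumUpTo R b (λ j → weight b j * H (suc j))
    shifted-part = trans (sumUpTo-shift b _) (trans (+-congʳ (zeroˡ _)) (+-identityˡ _))
    top-term : weight b (suc b) * H (suc b) ≈ 0#
    top-term = trans (*-congʳ (binomial-vanishes b (suc b) (n<1+n b) _)) (zeroˡ _)

  -- The iterated difference (Δ¹)^{b₁} ⋯ (Δᵖ)^{bₚ} F at the origin of ℕᵖ,
  -- expanded one coordinate at a time.
  iteratedDifference : {p : ℕ} → Vec ℕ p → (Vec ℕ p → Carrier) → Carrier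
  iteratedDifference []       F = F []
  iteratedDifference (b ∷ bs) F =
    sumUpTo R b (λ j → weight b j * iteratedDifference bs (λ is → F (j ∷ is)))

  iteratedDifference-cong : {p : ℕ} (b : Vec ℕ p) {F G : Vec ℕ p → Carrier} →
    (∀ v → F v ≈ G v) → iteratedDifference b F ≈ iteratedDifference b G
  iteratedDifference-cong []       F≈G = F≈G []
  iteratedDifference-cong (b ∷ bs) F≈G =
    sumUpTo-cong b (λ j _ → *-congˡ (iteratedDifference-cong bs (λ is → F≈G (j ∷ is))))

  iteratedDifference-bump : {p : ℕ} (k : Fin p) (b : Vec ℕ p) (F : Vec ℕ p → Carrier) →
    iteratedDifference (bump k b) F
      ≈ iteratedDifference b (F ∘ bump k) - iteratedDifference b F
  iteratedDifference-bump zero    (b ∷ bs) F =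
    difference-suc b (λ j → iteratedDifference bs (λ is → F (j ∷ is)))
  iteratedDifference-bump (suc k) (b ∷ bs) F =
    trans (sumUpTo-cong b (λ j _ → inner j)) (sumUpTo-sub b _ _)
    where
    inner : (j : ℕ) →
      weight b j * iteratedDifference (bump k bs) (λ is → F (j ∷ is))
        ≈ weight b j * iteratedDifference bs (λ is → F (j ∷ bump k is))
          - weight b j * iteratedDifference bs (λ is → F (j ∷ is))
    inner j = trans (*-congˡ (iteratedDifference-bump k bs (λ is → F (j ∷ is))))
                    (trans (distribˡ _ _ _) (+-congˡ (sym (-‿distribʳ-* _ _))))

  iteratedDifference-origin : (p : ℕ) (F : Vec ℕ p → Carrier) →
    iteratedDifference (tabulate (λ _ → 0)) F ≈ F (tabulate (λ _ → 0))
  iteratedDifference-origin zero    F = refl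
  iteratedDifference-origin (suc p) F =
    trans (*-cong (trans (*-identityˡ _) (+-identityʳ _)) (iteratedDifference-origin p _))
          (*-identityˡ _)

  -- The iterated difference written as the explicit box sum of the theorem:
  -- the product of the one-dimensional weights is the global sign times the
  -- product of binomial coefficients.
  iteratedDifference-expand : {p : ℕ} (b : Vec ℕ p) (F : Vec ℕ p → Carrier) →
    iteratedDifference b F
      ≈ sumBox R b (λ i → (negOnePow R (sumVec R b ∸ sumVec R i) * binomProd R b i) * F i)
  iteratedDifference-expand []       F = sym (trans (*-congʳ (*-identityˡ _)) (*-identityˡ _))
  iteratedDifference-expand {suc p} (b ∷ bs) F =
    sumUpTo-cong b (λ j j≤b →
      trans (*-congˡ (iteratedDifference-expand bs (λ is → F (j ∷ is))))
      (trans (sumBox-*ˡ _ bs _)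
             (sumBox-cong bs (λ is is≤bs → regroup j j≤b is is≤bs))))
    where
    -- Coordinate sums are monotone, so the global exponent Σb ∸ Σi never truncates.
    sumVec-mono : {q : ℕ} {is cs : Vec ℕ q} → is ≤ᵛ cs → sumVec R is ≤ sumVec R cs
    sumVec-mono []            = z≤n
    sumVec-mono (i≤c ∷ is≤cs) = +-mono-≤ i≤c (sumVec-mono is≤cs)

    regroup : (j : ℕ) → j ≤ b → (is : Vec ℕ p) → is ≤ᵛ bs →
      weight b j * ((negOnePow R (sumVec R bs ∸ sumVec R is) * binomProd R bs is) * F (j ∷ is))
        ≈ (negOnePow R ((b ℕ.+ sumVec R bs) ∸ (j ℕ.+ sumVec R is))
            * (fromℕ R (b C j) * binomProd R bs is)) * F (j ∷ is)
    regroup j j≤b is is≤bs = trans (sym (*-assoc _ _ _)) (*-congʳ (begin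
      weight b j * (negOnePow R (sumVec R bs ∸ sumVec R is) * binomProd R bs is)
        ≈⟨ *-interchange _ _ _ _ ⟩
      (negOnePow R (b ∸ j) * negOnePow R (sumVec R bs ∸ sumVec R is))
        * (fromℕ R (b C j) * binomProd R bs is)
        ≈⟨ *-congʳ (negOnePow-+ (b ∸ j) _) ⟨
      negOnePow R ((b ∸ j) ℕ.+ (sumVec R bs ∸ sumVec R is)) * (fromℕ R (b C j) * binomProd R bs is)
        ≈⟨ *-congʳ (reflexive (≡.cong (negOnePow R)
                     (∸-split b (sumVec R bs) j (sumVec R is) j≤b (sumVec-mono is≤bs)))) ⟨
      negOnePow R ((b ℕ.+ sumVec R bs) ∸ (j ℕ.+ sumVec R is))
        * (fromℕ R (b C j) * binomProd R bs is)
        ∎))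

  -- The iterated difference of G along the elements of B, at the empty set:
  -- each element x ∈ B contributes G(D ∪ {x}) - G(D).
  subsetDifference : {n : ℕ} → Subset n → (Subset n → Carrier) → Carrier
  subsetDifference []            G = G []
  subsetDifference (inside ∷ B)  G =
    subsetDifference B (G ∘ (inside ∷_)) - subsetDifference B (G ∘ (outside ∷_))
  subsetDifference (outside ∷ B) G = subsetDifference B (G ∘ (outside ∷_))

  subsetDifference-cong : {n : ℕ} (B : Subset n) {G H : Subset n → Carrier} →
    (∀ D → G D ≈ H D) → subsetDifference B G ≈ subsetDifference B H
  subsetDifference-cong []            G≈H = G≈H []
  subsetDifference-cong (inside ∷ B)  G≈H =
    +-cong (subsetDifference-cong B (G≈H ∘ (inside ∷_)))
           (-‿cong (subsetDifference-cong B (G≈H ∘ (outside ∷_))))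
  subsetDifference-cong (outside ∷ B) G≈H = subsetDifference-cong B (G≈H ∘ (outside ∷_))

  -- When G factors through profiles, a difference along x is the difference
  -- Δᵏ along the block k of x; hence the two iterated differences agree.
  subsetDifference-profile : {n p : ℕ} (cls : Fin n → Fin p) (B : Subset n)
    (F : Vec ℕ p → Carrier) →
    subsetDifference B (F ∘ profile cls) ≈ iteratedDifference (profile cls B) F
  subsetDifference-profile {zero} {p} cls [] F = sym (iteratedDifference-origin p F)
  subsetDifference-profile {suc n} cls (inside ∷ B) F = begin
    subsetDifference B (F ∘ profile cls ∘ (inside ∷_))
      - subsetDifference B (F ∘ profile (cls ∘ suc))
      ≈⟨ +-congʳ (subsetDifference-cong B (λ D → reflexive (≡.cong F (profile-inside cls D)))) ⟩
    subsetDifference B (F ∘ bump (cls zero) ∘ profile (cls ∘ suc))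
      - subsetDifference B (F ∘ profile (cls ∘ suc))
      ≈⟨ +-cong (subsetDifference-profile (cls ∘ suc) B (F ∘ bump (cls zero)))
                (-‿cong (subsetDifference-profile (cls ∘ suc) B F)) ⟩
    iteratedDifference (profile (cls ∘ suc) B) (F ∘ bump (cls zero))
      - iteratedDifference (profile (cls ∘ suc) B) F
      ≈⟨ iteratedDifference-bump (cls zero) (profile (cls ∘ suc) B) F ⟨
    iteratedDifference (bump (cls zero) (profile (cls ∘ suc) B)) F
      ≈⟨ reflexive (≡.cong (λ v → iteratedDifference v F) (profile-inside cls B)) ⟨
    iteratedDifference (profile cls (inside ∷ B)) F
      ∎
  subsetDifference-profile {suc n} cls (outside ∷ B) F =
    subsetDifference-profile (cls ∘ suc) B F

  sumList-cong : {A : Set} {f g : A → Carrier} (xs : List A) →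
    (∀ x → f x ≈ g x) → sumList R (map f xs) ≈ sumList R (map g xs)
  sumList-cong []       f≈g = refl
  sumList-cong (x ∷ xs) f≈g = +-cong (f≈g x) (sumList-cong xs f≈g)

  sumList-++ : (xs ys : List Carrier) → sumList R (xs ++ ys) ≈ sumList R xs + sumList R ys
  sumList-++ []       ys = sym (+-identityˡ _)
  sumList-++ (x ∷ xs) ys = trans (+-congˡ (sumList-++ xs ys)) (sym (+-assoc _ _ _))

  sumList-neg : {A : Set} (f : A → Carrier) (xs : List A) →
    sumList R (map (λ x → - f x) xs) ≈ - sumList R (map f xs)
  sumList-neg f []       = sym -0#≈0#
  sumList-neg f (x ∷ xs) = trans (+-congˡ (sumList-neg f xs)) (-‿+-comm _ _)

  sumList-zero : {A : Set} (xs : List A) → sumList R (map (λ _ → 0#) xs) ≈ 0#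
  sumList-zero []       = refl
  sumList-zero (x ∷ xs) = trans (+-congˡ (sumList-zero xs)) (+-identityˡ _)

  sumList-filter : {A : Set} {P : Pred A Level.zero} (P? : Decidable P) (h : A → Carrier)
    (xs : List A) →
    sumList R (map h (filter P? xs))
      ≈ sumList R (map (λ x → if does (P? x) then h x else 0#) xs)
  sumList-filter P? h []       = refl
  sumList-filter P? h (x ∷ xs) with does (P? x)
  ... | true  = +-congˡ (sumList-filter P? h xs)
  ... | false = trans (sumList-filter P? h xs) (sym (+-identityˡ _))

  mobiusTerm : {n : ℕ} → Subset n → (Subset n → Carrier) → Subset n → Carrier
  mobiusTerm B G D = if does (D ⊆? B) then negOnePow R ∣ B ─ D ∣ * G D else 0#

  -- For x ∈ B, a subset D ⊆ B missing x has one more element in B \ D.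
  mobiusTerm-outside : {n : ℕ} (B : Subset n) (G : Subset (suc n) → Carrier) (D : Subset n) →
    mobiusTerm (inside ∷ B) G (outside ∷ D) ≈ - mobiusTerm B (G ∘ (outside ∷_)) D
  mobiusTerm-outside B G D with does (D ⊆? B)
  ... | true  = sym (-‿distribˡ-* _ _)
  ... | false = sym -0#≈0#

  sum-mobiusTerm : (n : ℕ) (B : Subset n) (G : Subset n → Carrier) →
    sumList R (map (mobiusTerm B G) (allSubsets n)) ≈ subsetDifference B G
  sum-mobiusTerm zero    [] G = trans (+-identityʳ _) (*-identityˡ _)
  sum-mobiusTerm (suc n) (x ∷ B) G = begin
    sumList R (map (mobiusTerm (x ∷ B) G) (map (inside ∷_) Xs ++ map (outside ∷_) Xs))
      ≈⟨ reflexive (≡.cong (sumList R) (map-++ (mobiusTerm (x ∷ B) G) (map (inside ∷_) Xs) _)) ⟩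
    sumList R (map (mobiusTerm (x ∷ B) G) (map (inside ∷_) Xs)
               ++ map (mobiusTerm (x ∷ B) G) (map (outside ∷_) Xs))
      ≈⟨ sumList-++ (map (mobiusTerm (x ∷ B) G) (map (inside ∷_) Xs)) _ ⟩
    sumList R (map (mobiusTerm (x ∷ B) G) (map (inside ∷_) Xs))
      + sumList R (map (mobiusTerm (x ∷ B) G) (map (outside ∷_) Xs))
      ≈⟨ +-cong (reflexive (≡.cong (sumList R) (≡.sym (map-∘ Xs))))
                (reflexive (≡.cong (sumList R) (≡.sym (map-∘ Xs)))) ⟩
    sumList R (map (mobiusTerm (x ∷ B) G ∘ (inside ∷_)) Xs)
      + sumList R (map (mobiusTerm (x ∷ B) G ∘ (outside ∷_)) Xs)
      ≈⟨ by-first-point x ⟩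
    subsetDifference (x ∷ B) G
      ∎
    where
    Xs : List (Subset n)
    Xs = allSubsets n

    by-first-point : (x : Bool) →
      sumList R (map (mobiusTerm (x ∷ B) G ∘ (inside ∷_)) Xs)
        + sumList R (map (mobiusTerm (x ∷ B) G ∘ (outside ∷_)) Xs)
        ≈ subsetDifference (x ∷ B) G
    by-first-point inside = +-cong (sum-mobiusTerm n B _)
      (trans (sumList-cong Xs (mobiusTerm-outside B G))
             (trans (sumList-neg _ Xs) (-‿cong (sum-mobiusTerm n B _))))
    by-first-point outside =
      trans (+-cong (sumList-zero Xs) (sum-mobiusTerm n B _)) (+-identityˡ _)

  mobius-subsetDifference : {n : ℕ} (G : Subset n → Carrier) (B : Subset n) →
    mobius R G B ≈ subsetDifference B G
  mobius-subsetDifference {n} G B =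
    trans (sumList-filter (_⊆? B) _ (allSubsets n)) (sum-mobiusTerm n B G)

proposition4p1 : {c ℓ ℓ' : Level} (R : CommutativeRing c ℓ)
    (_≤_ : CommutativeRing.Carrier R → CommutativeRing.Carrier R → Set ℓ')
    (n p : ℕ) (μ : Subset n → CommutativeRing.Carrier R) (cls : Fin n → Fin p) →
    FuzzyMeasure R _≤_ μ → PSymmetric R μ cls →
    (μP : Vec ℕ p → CommutativeRing.Carrier R) →
    (∀ C → CommutativeRing._≈_ R (μP (profile cls C)) (μ C)) →
    (B : Subset n) →
    CommutativeRing._≈_ R (mobius R μ B)
      (sumBox R (profile cls B) (λ i →
        CommutativeRing._*_ R
          (CommutativeRing._*_ R
            (negOnePow R (sumVec R (profile cls B) ∸ sumVec R i))
            (binomProd R (profile cls B) i))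
          (μP i)))
proposition4p1 R _ n p μ cls _ _ μP μP-profile B = begin
  mobius R μ B                                  ≈⟨ mobius-subsetDifference R μ B ⟩
  subsetDifference R B μ                        ≈⟨ subsetDifference-cong R B (sym ∘ μP-profile) ⟩
  subsetDifference R B (μP ∘ profile cls)       ≈⟨ subsetDifference-profile R cls B μP ⟩
  iteratedDifference R (profile cls B) μP       ≈⟨ iteratedDifference-expand R (profile cls B) μP ⟩
  _                                             ∎
  where
  open CommutativeRing R using (sym; setoid)
  open import Relation.Binary.Reasoning.Setoid setoid
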